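{- Let $G$ be a finite simple graph with vertex set $V(G)=\{v_1,\dots,v_k,\dots,v_n\}$, where $1<k<n$, such that (i) $\bigcup_{i=1}^{k}N[v_i]=V(G)$; (ii) $|d(v_i)-d(v_j)|>1$ for every $i\in\{1,\dots,k\}$ and every $j\in\{1,\dots,n\}\setminus\{i\}$; (iii) $N[v_1]\cap \bigcup_{i=2}^{k}N[v_i]=\emptyset$. Let $G'$ be a finite simple graph with $V(G')=\{v'_1,\dots,v'_n\}$ such that $G-v_j\cong G'-v'_j$ for every $j\in\{1,\dots,n\}$. Then (i') $\bigcup_{i=1}^{k}N[v'_i]=V(G')$; (ii') $|d(v'_i)-d(v'_j)|>1$ for every $i\in\{1,\dots,k\}$ and every $j\in\{1,\dots,n\}\setminus\{i\}$; (iii') $N[v'_1]\cap \bigcup_{i=2}^{k}N[v'_i]=\emptyset$, where neighborhoods and degrees of the $v'_i$ are taken in $G'$.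
   Context: Graphs are finite, simple and undirected. For a vertex $v$, $d(v)$ denotes its degree, $N(v)$ the set of vertices adjacent to $v$, and $N[v]=N(v)\cup\{v\}$. $G-v$ denotes the graph obtained from $G$ by deleting the vertex $v$. -}

module Defs where

open import Data.Nat using (ℕ; suc; _<_; _≤_; ∣_-_∣)
open import Data.Bool using (Bool; true; false; if_then_else_)
open import Data.Fin using (Fin; zero; toℕ; punchIn)
open import Data.Fin.Permutation using (Permutation′; _⟨$⟩ʳ_)
open import Data.List using (map; allFin)
open import Data.Nat.ListAction using (sum)
open import Data.Product using (Σ; _×_; ∃-syntax)
open import Data.Sum using (_⊎_)
open import Relation.Binary.PropositionalEquality using (_≡_; _≢_)
open import Relation.Nullary using (¬_)

record Graph (n : ℕ) : Set where
  field
    adj   : Fin n → Fin n → Bool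
    sym   : ∀ u v → adj u v ≡ adj v u
    irrefl : ∀ v → adj v v ≡ false
open Graph public

degree : ∀ {n} → Graph n → Fin n → ℕ
degree {n} G v = sum (map (λ w → if adj G v w then 1 else 0) (allFin n))

InClosedNbhd : ∀ {n} → Graph n → Fin n → Fin n → Set
InClosedNbhd G v w = w ≡ v ⊎ adj G v w ≡ true

deleteVertex : ∀ {m} → Graph (suc m) → Fin (suc m) → Graph m
deleteVertex G v = record
  { adj = λ i j → adj G (punchIn v i) (punchIn v j)
  ; sym = λ i j → sym G (punchIn v i) (punchIn v j)
  ; irrefl = λ i → irrefl G (punchIn v i) }

_≅_ : ∀ {m} → Graph m → Graph m → Set
_≅_ {m} G H = Σ (Permutation′ m) λ σ → ∀ i j → adj H (σ ⟨$⟩ʳ i) (σ ⟨$⟩ʳ j) ≡ adj G i j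

-- The three conditions (i),(ii),(iii) for vertices v_1..v_k = Fin indices 0..k-1.
Cond1 : ∀ {n} → Graph n → ℕ → Set
Cond1 G k = ∀ w → ∃[ i ] (toℕ i < k × InClosedNbhd G i w)

Cond2 : ∀ {n} → Graph n → ℕ → Set
Cond2 G k = ∀ i j → toℕ i < k → j ≢ i → 1 < ∣ degree G i - degree G j ∣

Cond3 : ∀ {m} → Graph (suc m) → ℕ → Set
Cond3 G k = ∀ w → InClosedNbhd G zero w →
  ∀ i → 1 ≤ toℕ i → toℕ i < k → ¬ InClosedNbhd G i w

-- Every edge of G survives in exactly n − 2 of the cards G − v_j, so for n ≥ 3
-- the deck determines the number of edges e(G) (Kelly's lemma), hence every
-- degree d(v_j) = e(G) − e(G − v_j). In the card G − v_j the vertex v_i has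
-- degree d(v_i) − [v_i ~ v_j]; the isomorphism onto G' − v'_j sends it to a
-- vertex whose degree in G' (equal to its degree in G) is within 1 of d(v_i).
-- By (ii) that vertex is v_i itself, so [v_i ~ v_j] = [v'_i ~ v'_j]. Thus G and
-- G' have the same adjacencies at v_1, …, v_k, and (i)–(iii) transfer.
module Submission where

open import Defs renaming (sym to adj-sym)
open import Data.Bool using (Bool; true; false; if_then_else_)
open import Data.Empty using (⊥-elim)
open import Data.Fin using (Fin; zero; suc; toℕ; punchIn; punchOut)
open import Data.Fin.Permutation using (Permutation′; _⟨$⟩ʳ_)
open import Data.Fin.Properties using (punchIn-punchOut; punchIn-injective; _≟_)
open import Data.List using (tabulate)
open import Data.List.Properties using (map-tabulate)
open import Data.Nat using (ℕ; zero; suc; _+_; _*_; _<_; _≤_; ∣_-_∣; s≤s; z≤n; z<s)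
open import Data.Nat.Properties hiding (_≟_)
import Data.Nat.ListAction as List
open import Data.Nat.Tactic.RingSolver using (solve-∀)
open import Data.Product using (_×_; _,_; proj₁)
open import Data.Sum using (inj₁; inj₂)
open import Function using (_∘_)
open import Relation.Binary.PropositionalEquality
open import Relation.Nullary using (yes; no)

open import Algebra.Properties.Semiring.Sum +-*-semiring
  using (sum; sum-remove; sum-permute; ∑-distrib-+; sum-cong-≗; *-distribˡ-sum)

sum-tabulate : ∀ {n} (f : Fin n → ℕ) → List.sum (tabulate f) ≡ sum f
sum-tabulate {zero}  f = refl
sum-tabulate {suc n} f = cong (f zero +_) (sum-tabulate (f ∘ suc))

sum-const : ∀ n c → sum {n} (λ _ → c) ≡ n * c
sum-const zero    c = refl
sum-const (suc n) c = cong (c +_) (sum-const n c)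

m+[m+n]≡n+2*m : ∀ m n → m + (m + n) ≡ n + 2 * m
m+[m+n]≡n+2*m = solve-∀

𝟙 : Bool → ℕ
𝟙 b = if b then 1 else 0

𝟙-injective : ∀ {a b} → 𝟙 a ≡ 𝟙 b → a ≡ b
𝟙-injective {false} {false} _ = refl
𝟙-injective {true}  {true}  _ = refl

∣𝟙-𝟙∣≤1 : ∀ a b → ∣ 𝟙 a - 𝟙 b ∣ ≤ 1
∣𝟙-𝟙∣≤1 false false = z≤n
∣𝟙-𝟙∣≤1 false true  = ≤-refl
∣𝟙-𝟙∣≤1 true  false = ≤-refl
∣𝟙-𝟙∣≤1 true  true  = z≤n

∣𝟙+x-𝟙+x∣≤1 : ∀ a b x → ∣ 𝟙 a + x - 𝟙 b + x ∣ ≤ 1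
∣𝟙+x-𝟙+x∣≤1 a b x = begin
  ∣ 𝟙 a + x - 𝟙 b + x ∣ ≡⟨ cong₂ ∣_-_∣ (+-comm (𝟙 a) x) (+-comm (𝟙 b) x) ⟩
  ∣ x + 𝟙 a - x + 𝟙 b ∣ ≡⟨ ∣m+n-m+o∣≡∣n-o∣ x (𝟙 a) (𝟙 b) ⟩
  ∣ 𝟙 a - 𝟙 b ∣         ≤⟨ ∣𝟙-𝟙∣≤1 a b ⟩
  1                     ∎
  where open ≤-Reasoning

module _ {n : ℕ} where
  open ≡-Reasoning

  degree-∑ : (G : Graph n) (v : Fin n) → degree G v ≡ sum (𝟙 ∘ adj G v)
  degree-∑ G v = trans (cong List.sum (map-tabulate (λ w → w) (𝟙 ∘ adj G v)))
                       (sum-tabulate (𝟙 ∘ adj G v))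

  degreeSum : Graph n → ℕ
  degreeSum G = sum (degree G)

  degree-≅ : {G H : Graph n} ((σ , _) : G ≅ H) (v : Fin n) →
             degree H (σ ⟨$⟩ʳ v) ≡ degree G v
  degree-≅ {G} {H} (σ , σ-iso) v = begin
    degree H (σ ⟨$⟩ʳ v)                       ≡⟨ degree-∑ H _ ⟩
    sum (𝟙 ∘ adj H (σ ⟨$⟩ʳ v))                 ≡⟨ sum-permute (𝟙 ∘ adj H (σ ⟨$⟩ʳ v)) σ ⟩
    sum (λ w → 𝟙 (adj H (σ ⟨$⟩ʳ v) (σ ⟨$⟩ʳ w))) ≡⟨ sum-cong-≗ (cong 𝟙 ∘ σ-iso v) ⟩
    sum (𝟙 ∘ adj G v)                         ≡⟨ degree-∑ G v ⟨
    degree G v                                ∎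

  degreeSum-≅ : {G H : Graph n} → G ≅ H → degreeSum H ≡ degreeSum G
  degreeSum-≅ {G} {H} iso@(σ , _) =
    trans (sum-permute (degree H) σ) (sum-cong-≗ (degree-≅ {G} {H} iso))

module _ {m : ℕ} (G : Graph (suc m)) (j : Fin (suc m)) where
  open ≡-Reasoning

  degree-punchIn : ∀ i → degree G (punchIn j i) ≡
                   𝟙 (adj G (punchIn j i) j) + degree (deleteVertex G j) i
  degree-punchIn i = begin
    degree G (punchIn j i)                   ≡⟨ degree-∑ G _ ⟩
    sum (𝟙 ∘ adj G (punchIn j i))             ≡⟨ sum-remove {i = j} (𝟙 ∘ adj G (punchIn j i)) ⟩
    𝟙 (adj G (punchIn j i) j) + sum (𝟙 ∘ adj G (punchIn j i) ∘ punchIn j)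
      ≡⟨ cong (𝟙 (adj G (punchIn j i) j) +_) (degree-∑ (deleteVertex G j) i) ⟨
    𝟙 (adj G (punchIn j i) j) + degree (deleteVertex G j) i ∎

  sum-adj-punchIn : sum (λ i → 𝟙 (adj G (punchIn j i) j)) ≡ degree G j
  sum-adj-punchIn = begin
    sum (λ i → 𝟙 (adj G (punchIn j i) j))
      ≡⟨ sum-cong-≗ (λ i → cong 𝟙 (adj-sym G (punchIn j i) j)) ⟩
    sum (𝟙 ∘ adj G j ∘ punchIn j)
      ≡⟨ cong (λ b → 𝟙 b + sum (𝟙 ∘ adj G j ∘ punchIn j)) (irrefl G j) ⟨
    𝟙 (adj G j j) + sum (𝟙 ∘ adj G j ∘ punchIn j)
      ≡⟨ sum-remove {i = j} (𝟙 ∘ adj G j) ⟨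
    sum (𝟙 ∘ adj G j)
      ≡⟨ degree-∑ G j ⟨
    degree G j ∎

  degreeSum-deleteVertex : degreeSum G ≡ degreeSum (deleteVertex G j) + 2 * degree G j
  degreeSum-deleteVertex = begin
    degreeSum G                                   ≡⟨ sum-remove {i = j} (degree G) ⟩
    d + sum (degree G ∘ punchIn j)                ≡⟨ cong (d +_) (sum-cong-≗ degree-punchIn) ⟩
    d + sum (λ i → a i + degree (deleteVertex G j) i)
      ≡⟨ cong (d +_) (∑-distrib-+ a (degree (deleteVertex G j))) ⟩
    d + (sum a + T)                               ≡⟨ cong (λ e → d + (e + T)) sum-adj-punchIn ⟩
    d + (d + T)                                   ≡⟨ m+[m+n]≡n+2*m d T ⟩
    T + 2 * d                                     ∎
    where
    d T : ℕ
    d = degree G j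
    T = degreeSum (deleteVertex G j)
    a : Fin m → ℕ
    a i = 𝟙 (adj G (punchIn j i) j)

Hypomorphic : ∀ {m} → Graph (suc m) → Graph (suc m) → Set
Hypomorphic G G' = ∀ j → deleteVertex G j ≅ deleteVertex G' j

DegreeIsolated : ∀ {n} → Graph n → Fin n → Set
DegreeIsolated G i = ∀ j → j ≢ i → 1 < ∣ degree G i - degree G j ∣

sum-degreeSum-deleteVertex : ∀ {m} (G : Graph (suc (suc m))) →
  sum (degreeSum ∘ deleteVertex G) ≡ m * degreeSum G
sum-degreeSum-deleteVertex {m} G = +-cancelʳ-≡ (2 * s) _ _ (begin
  sum (degreeSum ∘ deleteVertex G) + 2 * s
    ≡⟨ cong (sum (degreeSum ∘ deleteVertex G) +_) (*-distribˡ-sum 2 (degree G)) ⟩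
  sum (degreeSum ∘ deleteVertex G) + sum (λ j → 2 * degree G j)
    ≡⟨ ∑-distrib-+ (degreeSum ∘ deleteVertex G) (λ j → 2 * degree G j) ⟨
  sum (λ j → degreeSum (deleteVertex G j) + 2 * degree G j)
    ≡⟨ sum-cong-≗ (λ j → degreeSum-deleteVertex G j) ⟨
  sum {2 + m} (λ _ → s)                           ≡⟨ sum-const (suc (suc m)) s ⟩
  (2 + m) * s                                     ≡⟨ *-distribʳ-+ s 2 m ⟩
  2 * s + m * s                                   ≡⟨ +-comm (2 * s) (m * s) ⟩
  m * s + 2 * s                                   ∎)
  where
  open ≡-Reasoning
  s : ℕ
  s = degreeSum G

module _ {m : ℕ} (G G' : Graph (3 + m)) (hyp : Hypomorphic G G') where
  open ≡-Reasoning

  degreeSum-hypomorphic : degreeSum G ≡ degreeSum G'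
  degreeSum-hypomorphic = *-cancelˡ-≡ _ _ (suc m) (begin
    suc m * degreeSum G               ≡⟨ sum-degreeSum-deleteVertex G ⟨
    sum (degreeSum ∘ deleteVertex G)
      ≡⟨ sum-cong-≗ (λ j → degreeSum-≅ {G = deleteVertex G j} {H = deleteVertex G' j} (hyp j)) ⟨
    sum (degreeSum ∘ deleteVertex G') ≡⟨ sum-degreeSum-deleteVertex G' ⟩
    suc m * degreeSum G'              ∎)

  degree-hypomorphic : ∀ v → degree G v ≡ degree G' v
  degree-hypomorphic v = *-cancelˡ-≡ _ _ 2 (+-cancelˡ-≡ T _ _ (begin
    T + 2 * degree G v                            ≡⟨ degreeSum-deleteVertex G v ⟨
    degreeSum G                                   ≡⟨ degreeSum-hypomorphic ⟩
    degreeSum G'                                  ≡⟨ degreeSum-deleteVertex G' v ⟩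
    degreeSum (deleteVertex G' v) + 2 * degree G' v
      ≡⟨ cong (_+ 2 * degree G' v) (degreeSum-≅ {G = deleteVertex G v} {H = deleteVertex G' v} (hyp v)) ⟩
    T + 2 * degree G' v                           ∎))
    where
    T : ℕ
    T = degreeSum (deleteVertex G v)

module _ {m : ℕ} {G G' : Graph (suc m)} {j : Fin (suc m)}
         (degree≡ : ∀ v → degree G v ≡ degree G' v)
         (card : deleteVertex G j ≅ deleteVertex G' j) where
  private
    σ : Permutation′ m
    σ = proj₁ card

  degree-card : ∀ i → degree G (punchIn j (σ ⟨$⟩ʳ i)) ≡
    𝟙 (adj G' (punchIn j (σ ⟨$⟩ʳ i)) j) + degree (deleteVertex G j) i
  degree-card i = begin
    degree G (punchIn j (σ ⟨$⟩ʳ i))  ≡⟨ degree≡ _ ⟩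
    degree G' (punchIn j (σ ⟨$⟩ʳ i)) ≡⟨ degree-punchIn G' j _ ⟩
    𝟙 (adj G' (punchIn j (σ ⟨$⟩ʳ i)) j) + degree (deleteVertex G' j) (σ ⟨$⟩ʳ i)
      ≡⟨ cong (𝟙 (adj G' (punchIn j (σ ⟨$⟩ʳ i)) j) +_)
              (degree-≅ {G = deleteVertex G j} {H = deleteVertex G' j} card i) ⟩
    𝟙 (adj G' (punchIn j (σ ⟨$⟩ʳ i)) j) + degree (deleteVertex G j) i ∎
    where open ≡-Reasoning

  DegreeIsolated⇒adj-punchIn≡ : ∀ i → DegreeIsolated G (punchIn j i) →
    adj G (punchIn j i) j ≡ adj G' (punchIn j i) j
  DegreeIsolated⇒adj-punchIn≡ i isolated with σ ⟨$⟩ʳ i ≟ i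
  ... | yes σi≡i = 𝟙-injective (+-cancelʳ-≡ _ _ _ (trans (sym (degree-punchIn G j i))
        (subst (λ v → degree G (punchIn j v) ≡ 𝟙 (adj G' (punchIn j v) j) + _) σi≡i (degree-card i))))
  ... | no σi≢i = ⊥-elim (<⇒≱ (isolated _ (σi≢i ∘ punchIn-injective j _ _))
        (subst₂ (λ p q → ∣ p - q ∣ ≤ 1) (sym (degree-punchIn G j i)) (sym (degree-card i))
          (∣𝟙+x-𝟙+x∣≤1 (adj G (punchIn j i) j) (adj G' (punchIn j (σ ⟨$⟩ʳ i)) j)
                        (degree (deleteVertex G j) i))))

DegreeIsolated⇒adj≡ : ∀ {m} {G G' : Graph (suc m)} {i j : Fin (suc m)} →
  (∀ v → degree G v ≡ degree G' v) → deleteVertex G j ≅ deleteVertex G' j →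
  DegreeIsolated G i → adj G i j ≡ adj G' i j
DegreeIsolated⇒adj≡ {G = G} {G'} {i} {j} degree≡ card isolated with j ≟ i
... | yes refl = trans (irrefl G j) (sym (irrefl G' j))
... | no j≢i = subst (λ v → adj G v j ≡ adj G' v j) (punchIn-punchOut j≢i)
  (DegreeIsolated⇒adj-punchIn≡ {G = G} {G'} {j} degree≡ card (punchOut j≢i)
    (subst (DegreeIsolated G) (sym (punchIn-punchOut j≢i)) isolated))

InClosedNbhd-cong : ∀ {n} {G H : Graph n} {i} → (∀ w → adj G i w ≡ adj H i w) →
  ∀ {w} → InClosedNbhd G i w → InClosedNbhd H i w
InClosedNbhd-cong row (inj₁ w≡i) = inj₁ w≡i
InClosedNbhd-cong row (inj₂ i~w) = inj₂ (trans (sym (row _)) i~w)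

lemma2 : ∀ (m k : ℕ) (G G' : Graph (suc m)) →
    1 < k → k < suc m →
    Cond1 G k → Cond2 G k → Cond3 G k →
    (∀ j → deleteVertex G j ≅ deleteVertex G' j) →
    Cond1 G' k × Cond2 G' k × Cond3 G' k
lemma2 zero          k G G' (s≤s (s≤s _)) (s≤s ())
lemma2 (suc zero)    k G G' (s≤s (s≤s _)) (s≤s (s≤s ()))
lemma2 (suc (suc m)) k G G' 1<k _ cond1 cond2 cond3 hyp =
  cond1′ , cond2′ , cond3′
  where
  degree≡ : ∀ v → degree G v ≡ degree G' v
  degree≡ = degree-hypomorphic G G' hyp
  row≡ : ∀ i → toℕ i < k → ∀ w → adj G i w ≡ adj G' i w
  row≡ i i<k w = DegreeIsolated⇒adj≡ {G = G} {G'} {i} {w} degree≡ (hyp w) (λ j → cond2 i j i<k)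
  N[_]⊆N′ : ∀ i → toℕ i < k → ∀ {w} → InClosedNbhd G i w → InClosedNbhd G' i w
  N[ i ]⊆N′ i<k = InClosedNbhd-cong {G = G} {H = G'} (row≡ i i<k)
  N′[_]⊆N : ∀ i → toℕ i < k → ∀ {w} → InClosedNbhd G' i w → InClosedNbhd G i w
  N′[ i ]⊆N i<k = InClosedNbhd-cong {G = G'} {H = G} (sym ∘ row≡ i i<k)
  cond1′ : Cond1 G' k
  cond1′ w with cond1 w
  ... | i , i<k , w∈N[i] = i , i<k , N[ i ]⊆N′ i<k w∈N[i]
  cond2′ : Cond2 G' k
  cond2′ i j i<k j≢i = subst₂ (λ p q → 1 < ∣ p - q ∣) (degree≡ i) (degree≡ j) (cond2 i j i<k j≢i)
  cond3′ : Cond3 G' k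
  cond3′ w w∈N′[0] i 1≤i i<k w∈N′[i] =
    cond3 w (N′[ zero ]⊆N (<-trans z<s 1<k) w∈N′[0]) i 1≤i i<k (N′[ i ]⊆N i<k w∈N′[i])
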